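{- For every odd integer $k \geq 3$ and every integer $e \geq 1$, $g_{\mathbb{Z}_2[\sqrt[e]{2}]}(k) = 2$.
   Context: For a ring $R$ and an integer $k > 1$, let $R^k$ denote the additive semigroup generated by all $k$-th powers of elements of $R$. The Waring number $g_R(k)$ is the smallest positive integer such that every element of $R^k$ can be written as a sum of at most $g_R(k)$ $k$-th powers of elements of $R$. $\mathbb{Z}_2[\sqrt[e]{2}]$ is the ring of integers of $\mathbb{Q}_2(\sqrt[e]{2})$. -}

module Defs where

open import Data.Nat using (ℕ; zero; suc; _≤_; _^_)
open import Data.Integer using (ℤ; +_; _+_; _*_; _-_)
open import Data.Integer.Divisibility using (_∣_)
open import Data.Fin using (Fin)
open import Data.Vec using (Vec; []; _∷_; replicate; zipWith; map; last; init; lookup)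
open import Data.List using (List; []; _∷_; length)
open import Data.Product using (Σ; ∃; _×_; proj₁; proj₂; _,_)
open import Relation.Nullary using (¬_)

-- The ring Z[π] = Z[x]/(x^e - 2), elements = coefficient vectors
-- (a₀,…,a_{e-1}) in the basis 1, π, …, π^{e-1}, where π^e = 2.

ZPi : ℕ → Set
ZPi e = Vec ℤ e

zeroZ : ∀ {e} → ZPi e
zeroZ {e} = replicate e (+ 0)

oneZ : ∀ {e} → ZPi e
oneZ {zero}  = []
oneZ {suc e} = + 1 ∷ replicate e (+ 0)

addZ : ∀ {e} → ZPi e → ZPi e → ZPi e
addZ = zipWith _+_

scaleZ : ∀ {e} → ℤ → ZPi e → ZPi e
scaleZ c = map (c *_)

mulπ : ∀ {e} → ZPi e → ZPi e
mulπ {zero}  v = []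
mulπ {suc e} v = (+ 2 * last v) ∷ init v

-- Horner: (a₀ + π a₁ + π² a₂ + …) · b
mulAux : ∀ {n e} → Vec ℤ n → ZPi e → ZPi e
mulAux []       b = zeroZ
mulAux (a ∷ as) b = addZ (scaleZ a b) (mulπ (mulAux as b))

mulZ : ∀ {e} → ZPi e → ZPi e → ZPi e
mulZ = mulAux

powZ : ∀ {e} → ZPi e → ℕ → ZPi e
powZ x zero    = oneZ
powZ x (suc k) = mulZ x (powZ x k)

-- The completion Z₂[π] = lim_n Z[π]/2ⁿZ[π], which is the ring of
-- integers of Q₂(2^{1/e}).  Elements are represented by compatible
-- sequences (f n) in Z[π] with f (n+1) ≡ f n (mod 2ⁿ), and two such
-- sequences are equal in Z₂[π] iff f n ≡ g n (mod 2ⁿ) for all n.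

Seq : ℕ → Set
Seq e = ℕ → ZPi e

CongMod : ∀ {e} → ℕ → ZPi e → ZPi e → Set
CongMod {e} n u v = (i : Fin e) → (+ (2 ^ n)) ∣ (lookup u i - lookup v i)

IsCompatible : ∀ {e} → Seq e → Set
IsCompatible f = ∀ n → CongMod n (f (suc n)) (f n)

Z2Root : ℕ → Set
Z2Root e = Σ (Seq e) IsCompatible

_≈_ : ∀ {e} → Z2Root e → Z2Root e → Set
x ≈ y = ∀ n → CongMod n (proj₁ x n) (proj₁ y n)

sumPowSeq : ∀ {e} → ℕ → List (Z2Root e) → Seq e
sumPowSeq k []       n = zeroZ
sumPowSeq k (x ∷ xs) n = addZ (powZ (proj₁ x n) k) (sumPowSeq k xs n)

IsSumOfPowers : ∀ {e} → ℕ → Z2Root e → List (Z2Root e) → Set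
IsSumOfPowers k y xs = ∀ n → CongMod n (proj₁ y n) (sumPowSeq k xs n)

InPowSemigroup : ∀ {e} → ℕ → Z2Root e → Set
InPowSemigroup {e} k y = Σ (List (Z2Root e)) λ xs → IsSumOfPowers k y xs

WaringBound : ℕ → ℕ → ℕ → Set
WaringBound e k g = (y : Z2Root e) → InPowSemigroup k y →
  Σ (List (Z2Root e)) λ xs → (length xs ≤ g) × IsSumOfPowers k y xs

IsWaringNumber : ℕ → ℕ → ℕ → Set
IsWaringNumber e k g =
  (1 ≤ g) × WaringBound e k g × (∀ g′ → 1 ≤ g′ → WaringBound e k g′ → g ≤ g′)

{-# OPTIONS --safe #-}
-- Write e = m + 1 and π = 2^(1/e).  The ring Z₂[π] is local with residue field F₂, so its units
-- are the elements with odd constant coefficient.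
--
-- Every unit u is a k-th power: u ^ 2^(n + m) ≡ 1 modulo 2^(n + 1), and the odd number k is
-- invertible modulo 2^(n + m), so the levelwise roots u ^ (k⁻¹ mod 2^(n + m)) form a compatible
-- sequence.  A non-unit y is 1 + (y - 1) with y - 1 a unit, hence a sum of two k-th powers.
--
-- One k-th power does not suffice: π = 1 + (π - 1) is a sum of two k-th powers, but every k-th
-- power is a unit or lies in π^k Z₂[π] ⊆ π² Z₂[π], and π is neither; as 4 ∈ π² Z₂[π], this is
-- already visible modulo 4.
module Submission where

open import Defs
open import Data.Nat using (ℕ; _≤_)
open import Data.Nat.Divisibility using (_∣_)
open import Relation.Nullary using (¬_)

import Data.Nat as ℕ
import Data.Nat.Properties as ℕ
import Data.Nat.Divisibility as ℕ
import Data.Nat.Tactic.RingSolver as ℕ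
open import Data.Nat.Base using (zero; suc; z≤n; s≤s)
open import Data.Integer.Base using (ℤ; +_; _+_; _*_; _-_; -_; _^_; _%ℕ_; _/ℕ_)
import Data.Integer.Properties as ℤ
open import Data.Integer.DivMod using (n%ℕd<d; a≡a%ℕn+[a/ℕn]*n)
open import Data.Integer.Divisibility.Signed
  using (divides; ∣-refl; ∣-trans; ∣m∣n⇒∣m+n; ∣m∣n⇒∣m-n; ∣n⇒∣m*n; ∣m⇒∣m*n; *-monoˡ-∣; ∣⇒∣ᵤ; ∣ᵤ⇒∣)
  renaming (_∣_ to _∣ᶻ_)
open import Data.Integer.Tactic.RingSolver using (solve-∀)
open import Data.Fin.Base using (Fin; zero; suc; toℕ; fromℕ; inject₁)
open import Data.Fin.Properties using (toℕ-inject₁; toℕ<n)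
open import Data.Vec.Base using (Vec; []; _∷_; _∷ʳ_; zipWith; lookup; padRight; initLast; init; last)
open import Data.Vec.Properties
  using ( lookup-zipWith; lookup-map; lookup-replicate; init-∷ʳ; last-∷ʳ; map-∷ʳ; padRight-refl
        ; zipWith-assoc; zipWith-identityˡ; zipWith-identityʳ)
open import Data.List.Base using (List; []; _∷_; length)
open import Data.Product using (Σ; ∃; _×_; _,_; proj₁; proj₂)
open import Data.Sum using (_⊎_; inj₁; inj₂)
open import Data.Empty using (⊥-elim)
open import Function.Base using (_∘_)
open import Level using (0ℓ)
open import Relation.Binary.Bundles using (Setoid)
import Relation.Binary.Reasoning.Setoid
open import Relation.Binary.PropositionalEquality

private
  variable
    n e j : ℕ
    d : ℤ

-- Z[π] as a commutative ring

zipWith-∷ʳ : ∀ {A B C : Set} (f : A → B → C) (xs : Vec A n) (ys : Vec B n) x y →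
             zipWith f (xs ∷ʳ x) (ys ∷ʳ y) ≡ zipWith f xs ys ∷ʳ f x y
zipWith-∷ʳ f []        []        x y = refl
zipWith-∷ʳ f (x′ ∷ xs) (y′ ∷ ys) x y = cong (f x′ y′ ∷_) (zipWith-∷ʳ f xs ys x y)

zeroZ-∷ʳ : ∀ n → zeroZ {suc n} ≡ zeroZ {n} ∷ʳ + 0
zeroZ-∷ʳ zero    = refl
zeroZ-∷ʳ (suc n) = cong (+ 0 ∷_) (zeroZ-∷ʳ n)

padRight-suc : (p : n ≤ e) (xs : Vec ℤ n) →
               padRight (ℕ.m≤n⇒m≤1+n p) (+ 0) xs ≡ padRight p (+ 0) xs ∷ʳ + 0
padRight-suc z≤n     []       = zeroZ-∷ʳ _
padRight-suc (s≤s p) (x ∷ xs) = cong (x ∷_) (padRight-suc p xs)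

addZ-assoc : (u v w : ZPi e) → addZ (addZ u v) w ≡ addZ u (addZ v w)
addZ-assoc = zipWith-assoc ℤ.+-assoc

addZ-identityˡ : (u : ZPi e) → addZ zeroZ u ≡ u
addZ-identityˡ = zipWith-identityˡ ℤ.+-identityˡ

addZ-identityʳ : (u : ZPi e) → addZ u zeroZ ≡ u
addZ-identityʳ = zipWith-identityʳ ℤ.+-identityʳ

addZ-interchange : (a b c d : ZPi e) → addZ (addZ a b) (addZ c d) ≡ addZ (addZ a c) (addZ b d)
addZ-interchange []       []       []       []       = refl
addZ-interchange (a ∷ as) (b ∷ bs) (c ∷ cs) (d ∷ ds) =
  cong₂ _∷_ (interchange a b c d) (addZ-interchange as bs cs ds)
  where
  interchange : ∀ a b c d → (a + b) + (c + d) ≡ (a + c) + (b + d)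
  interchange = solve-∀

scaleZ-addZ : ∀ c (u v : ZPi e) → scaleZ c (addZ u v) ≡ addZ (scaleZ c u) (scaleZ c v)
scaleZ-addZ c []      []      = refl
scaleZ-addZ c (x ∷ u) (y ∷ v) = cong₂ _∷_ (ℤ.*-distribˡ-+ c x y) (scaleZ-addZ c u v)

scaleZ-+ : ∀ c c′ (u : ZPi e) → scaleZ (c + c′) u ≡ addZ (scaleZ c u) (scaleZ c′ u)
scaleZ-+ c c′ []      = refl
scaleZ-+ c c′ (x ∷ u) = cong₂ _∷_ (ℤ.*-distribʳ-+ x c c′) (scaleZ-+ c c′ u)

scaleZ-exchange : ∀ c c′ (u : ZPi e) → scaleZ c (scaleZ c′ u) ≡ scaleZ c′ (scaleZ c u)
scaleZ-exchange c c′ []      = refl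
scaleZ-exchange c c′ (x ∷ u) = cong₂ _∷_ (exchange c c′ x) (scaleZ-exchange c c′ u)
  where
  exchange : ∀ c c′ x → c * (c′ * x) ≡ c′ * (c * x)
  exchange = solve-∀

scaleZ-zeroʳ : ∀ c → scaleZ c (zeroZ {e}) ≡ zeroZ
scaleZ-zeroʳ {zero}  c = refl
scaleZ-zeroʳ {suc e} c = cong₂ _∷_ (ℤ.*-zeroʳ c) (scaleZ-zeroʳ c)

mulπ-∷ʳ : (w : Vec ℤ n) (a : ℤ) → mulπ (w ∷ʳ a) ≡ + 2 * a ∷ w
mulπ-∷ʳ w a = cong₂ _∷_ (cong (+ 2 *_) (last-∷ʳ a w)) (init-∷ʳ a w)

mulπ-zeroZ : mulπ (zeroZ {e}) ≡ zeroZ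
mulπ-zeroZ {zero}  = refl
mulπ-zeroZ {suc e} = trans (cong mulπ (zeroZ-∷ʳ e)) (mulπ-∷ʳ zeroZ (+ 0))

-- In the next two proofs, matching on initLast u also unfolds mulπ u on the right to + 2 * a ∷ w.
mulπ-addZ : (u v : ZPi e) → mulπ (addZ u v) ≡ addZ (mulπ u) (mulπ v)
mulπ-addZ {zero}  [] [] = refl
mulπ-addZ {suc e} u v with initLast u | initLast v
... | w , a , refl | w′ , a′ , refl = begin
  mulπ (addZ (w ∷ʳ a) (w′ ∷ʳ a′))      ≡⟨ cong mulπ (zipWith-∷ʳ _+_ w w′ a a′) ⟩
  mulπ (addZ w w′ ∷ʳ (a + a′))         ≡⟨ mulπ-∷ʳ (addZ w w′) (a + a′) ⟩
  + 2 * (a + a′) ∷ addZ w w′           ≡⟨ cong (_∷ addZ w w′) (ℤ.*-distribˡ-+ (+ 2) a a′) ⟩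
  addZ (+ 2 * a ∷ w) (+ 2 * a′ ∷ w′)   ∎
  where open ≡-Reasoning

mulπ-scaleZ : ∀ c (u : ZPi e) → mulπ (scaleZ c u) ≡ scaleZ c (mulπ u)
mulπ-scaleZ {zero}  c [] = refl
mulπ-scaleZ {suc e} c u with initLast u
... | w , a , refl = begin
  mulπ (scaleZ c (w ∷ʳ a))     ≡⟨ cong mulπ (map-∷ʳ (c *_) a w) ⟩
  mulπ (scaleZ c w ∷ʳ c * a)   ≡⟨ mulπ-∷ʳ (scaleZ c w) (c * a) ⟩
  + 2 * (c * a) ∷ scaleZ c w   ≡⟨ cong (_∷ scaleZ c w) (exchange (+ 2) c a) ⟩
  scaleZ c (+ 2 * a ∷ w)       ∎
  where
  open ≡-Reasoning
  exchange : ∀ c c′ x → c * (c′ * x) ≡ c′ * (c * x)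
  exchange = solve-∀

mulAux-zeroʳ : (a : Vec ℤ n) → mulAux a (zeroZ {e}) ≡ zeroZ
mulAux-zeroʳ []      = refl
mulAux-zeroʳ (x ∷ a) = begin
  addZ (scaleZ x zeroZ) (mulπ (mulAux a zeroZ))
    ≡⟨ cong₂ addZ (scaleZ-zeroʳ x) (trans (cong mulπ (mulAux-zeroʳ a)) mulπ-zeroZ) ⟩
  addZ zeroZ zeroZ
    ≡⟨ addZ-identityʳ zeroZ ⟩
  zeroZ ∎
  where open ≡-Reasoning

mulAux-addZʳ : (a : Vec ℤ n) (b c : ZPi e) → mulAux a (addZ b c) ≡ addZ (mulAux a b) (mulAux a c)
mulAux-addZʳ []      b c = sym (addZ-identityʳ zeroZ)
mulAux-addZʳ (x ∷ a) b c = begin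
  addZ (scaleZ x (addZ b c)) (mulπ (mulAux a (addZ b c)))
    ≡⟨ cong₂ addZ (scaleZ-addZ x b c) (trans (cong mulπ (mulAux-addZʳ a b c)) (mulπ-addZ _ _)) ⟩
  addZ (addZ (scaleZ x b) (scaleZ x c)) (addZ (mulπ (mulAux a b)) (mulπ (mulAux a c)))
    ≡⟨ addZ-interchange _ _ _ _ ⟩
  addZ (addZ (scaleZ x b) (mulπ (mulAux a b))) (addZ (scaleZ x c) (mulπ (mulAux a c))) ∎
  where open ≡-Reasoning

mulAux-scaleZʳ : (a : Vec ℤ n) (c : ℤ) (b : ZPi e) → mulAux a (scaleZ c b) ≡ scaleZ c (mulAux a b)
mulAux-scaleZʳ []      c b = sym (scaleZ-zeroʳ c)
mulAux-scaleZʳ (x ∷ a) c b = begin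
  addZ (scaleZ x (scaleZ c b)) (mulπ (mulAux a (scaleZ c b)))
    ≡⟨ cong₂ addZ (scaleZ-exchange x c b) (trans (cong mulπ (mulAux-scaleZʳ a c b)) (mulπ-scaleZ c _)) ⟩
  addZ (scaleZ c (scaleZ x b)) (scaleZ c (mulπ (mulAux a b)))
    ≡⟨ scaleZ-addZ c _ _ ⟨
  scaleZ c (addZ (scaleZ x b) (mulπ (mulAux a b))) ∎
  where open ≡-Reasoning

mulAux-mulπʳ : (a : Vec ℤ n) (b : ZPi e) → mulAux a (mulπ b) ≡ mulπ (mulAux a b)
mulAux-mulπʳ []      b = sym mulπ-zeroZ
mulAux-mulπʳ (x ∷ a) b = begin
  addZ (scaleZ x (mulπ b)) (mulπ (mulAux a (mulπ b)))
    ≡⟨ cong₂ addZ (sym (mulπ-scaleZ x b)) (cong mulπ (mulAux-mulπʳ a b)) ⟩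
  addZ (mulπ (scaleZ x b)) (mulπ (mulπ (mulAux a b)))
    ≡⟨ mulπ-addZ _ _ ⟨
  mulπ (addZ (scaleZ x b) (mulπ (mulAux a b))) ∎
  where open ≡-Reasoning

mulAux-exchange : ∀ {k} (a : Vec ℤ n) (b : Vec ℤ k) (c : ZPi e) →
                  mulAux a (mulAux b c) ≡ mulAux b (mulAux a c)
mulAux-exchange a []      c = mulAux-zeroʳ a
mulAux-exchange a (y ∷ b) c = begin
  mulAux a (addZ (scaleZ y c) (mulπ (mulAux b c)))
    ≡⟨ mulAux-addZʳ a _ _ ⟩
  addZ (mulAux a (scaleZ y c)) (mulAux a (mulπ (mulAux b c)))
    ≡⟨ cong₂ addZ (mulAux-scaleZʳ a y c) (mulAux-mulπʳ a _) ⟩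
  addZ (scaleZ y (mulAux a c)) (mulπ (mulAux a (mulAux b c)))
    ≡⟨ cong (addZ (scaleZ y (mulAux a c)) ∘ mulπ) (mulAux-exchange a b c) ⟩
  addZ (scaleZ y (mulAux a c)) (mulπ (mulAux b (mulAux a c))) ∎
  where open ≡-Reasoning

mulAux-addZˡ : (a a′ : Vec ℤ n) (b : ZPi e) → mulAux (addZ a a′) b ≡ addZ (mulAux a b) (mulAux a′ b)
mulAux-addZˡ []      []        b = sym (addZ-identityʳ zeroZ)
mulAux-addZˡ (x ∷ a) (x′ ∷ a′) b = begin
  addZ (scaleZ (x + x′) b) (mulπ (mulAux (addZ a a′) b))
    ≡⟨ cong₂ addZ (scaleZ-+ x x′ b) (trans (cong mulπ (mulAux-addZˡ a a′ b)) (mulπ-addZ _ _)) ⟩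
  addZ (addZ (scaleZ x b) (scaleZ x′ b)) (addZ (mulπ (mulAux a b)) (mulπ (mulAux a′ b)))
    ≡⟨ addZ-interchange _ _ _ _ ⟩
  addZ (addZ (scaleZ x b) (mulπ (mulAux a b))) (addZ (scaleZ x′ b) (mulπ (mulAux a′ b))) ∎
  where open ≡-Reasoning

mulAux-oneZʳ : (p : n ≤ e) (a : Vec ℤ n) → mulAux a oneZ ≡ padRight p (+ 0) a
mulAux-oneZʳ z≤n     []      = refl
mulAux-oneZʳ (s≤s p) (x ∷ a) = begin
  addZ (scaleZ x oneZ) (mulπ (mulAux a oneZ))
    ≡⟨ cong (addZ (scaleZ x oneZ) ∘ mulπ) (trans (mulAux-oneZʳ (ℕ.m≤n⇒m≤1+n p) a) (padRight-suc p a)) ⟩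
  addZ (scaleZ x oneZ) (mulπ (padRight p (+ 0) a ∷ʳ + 0))
    ≡⟨ cong (addZ (scaleZ x oneZ)) (mulπ-∷ʳ _ _) ⟩
  x * + 1 + + 0 ∷ addZ (scaleZ x zeroZ) (padRight p (+ 0) a)
    ≡⟨ cong₂ _∷_ (trans (ℤ.+-identityʳ _) (ℤ.*-identityʳ x))
                 (trans (cong (λ z → addZ z _) (scaleZ-zeroʳ x)) (addZ-identityˡ _)) ⟩
  x ∷ padRight p (+ 0) a ∎
  where open ≡-Reasoning

mulZ-identityʳ : (a : ZPi e) → mulZ a oneZ ≡ a
mulZ-identityʳ a = trans (mulAux-oneZʳ ℕ.≤-refl a) (padRight-refl (+ 0) a)

mulZ-comm : (a b : ZPi e) → mulZ a b ≡ mulZ b a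
mulZ-comm a b = begin
  mulAux a b                 ≡⟨ cong (mulAux a) (mulZ-identityʳ b) ⟨
  mulAux a (mulAux b oneZ)   ≡⟨ mulAux-exchange a b oneZ ⟩
  mulAux b (mulAux a oneZ)   ≡⟨ cong (mulAux b) (mulZ-identityʳ a) ⟩
  mulAux b a                 ∎
  where open ≡-Reasoning

mulZ-identityˡ : (b : ZPi e) → mulZ oneZ b ≡ b
mulZ-identityˡ b = trans (mulZ-comm oneZ b) (mulZ-identityʳ b)

mulZ-assoc : (a b c : ZPi e) → mulZ (mulZ a b) c ≡ mulZ a (mulZ b c)
mulZ-assoc a b c = begin
  mulAux (mulAux a b) c   ≡⟨ mulZ-comm (mulAux a b) c ⟩
  mulAux c (mulAux a b)   ≡⟨ mulAux-exchange c a b ⟩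
  mulAux a (mulAux c b)   ≡⟨ cong (mulAux a) (mulZ-comm c b) ⟩
  mulAux a (mulAux b c)   ∎
  where open ≡-Reasoning

mulZ-mulπˡ : (a b : ZPi e) → mulZ (mulπ a) b ≡ mulπ (mulZ a b)
mulZ-mulπˡ a b = begin
  mulZ (mulπ a) b   ≡⟨ mulZ-comm (mulπ a) b ⟩
  mulZ b (mulπ a)   ≡⟨ mulAux-mulπʳ b a ⟩
  mulπ (mulZ b a)   ≡⟨ cong mulπ (mulZ-comm b a) ⟩
  mulπ (mulZ a b)   ∎
  where open ≡-Reasoning

powZ-+ : (u : ZPi e) (a b : ℕ) → powZ u (a ℕ.+ b) ≡ mulZ (powZ u a) (powZ u b)
powZ-+ u zero    b = sym (mulZ-identityˡ (powZ u b))
powZ-+ u (suc a) b = trans (cong (mulZ u) (powZ-+ u a b)) (sym (mulZ-assoc u (powZ u a) (powZ u b)))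

powZ-* : (u : ZPi e) (a b : ℕ) → powZ u (a ℕ.* b) ≡ powZ (powZ u b) a
powZ-* u zero    b = refl
powZ-* u (suc a) b = trans (powZ-+ u b (a ℕ.* b)) (cong (mulZ (powZ u b)) (powZ-* u a b))

powZ-double : (u : ZPi e) (a : ℕ) → powZ u (2 ℕ.* a) ≡ mulZ (powZ u a) (powZ u a)
powZ-double u a = trans (powZ-* u 2 a) (cong (mulZ (powZ u a)) (mulZ-identityʳ (powZ u a)))

powZ-oneZ : (a : ℕ) → powZ (oneZ {e}) a ≡ oneZ
powZ-oneZ zero    = refl
powZ-oneZ (suc a) = trans (mulZ-identityˡ _) (powZ-oneZ a)

subZ : Vec ℤ n → Vec ℤ n → Vec ℤ n
subZ = zipWith _-_

addZ-subZ : (u v : Vec ℤ n) → addZ v (subZ u v) ≡ u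
addZ-subZ []      []      = refl
addZ-subZ (x ∷ u) (y ∷ v) = cong₂ _∷_ (cancel x y) (addZ-subZ u v)
  where
  cancel : ∀ x y → y + (x - y) ≡ x
  cancel = solve-∀

subZ-addZ : (u v : Vec ℤ n) → subZ (addZ v u) v ≡ u
subZ-addZ []      []      = refl
subZ-addZ (x ∷ u) (y ∷ v) = cong₂ _∷_ (cancel x y) (subZ-addZ u v)
  where
  cancel : ∀ x y → (y + x) - y ≡ x
  cancel = solve-∀

square-sub-one : (u : ZPi e) → let w = subZ u oneZ in
                 subZ (mulZ u u) oneZ ≡ addZ (addZ w w) (mulZ w w)
square-sub-one u = begin
  subZ (mulZ u u) oneZ
    ≡⟨ cong (λ v → subZ (mulZ v v) oneZ) (addZ-subZ u oneZ) ⟨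
  subZ (mulZ (addZ oneZ w) (addZ oneZ w)) oneZ
    ≡⟨ cong (λ v → subZ v oneZ) expand ⟩
  subZ (addZ oneZ (addZ (addZ w w) (mulZ w w))) oneZ
    ≡⟨ subZ-addZ _ oneZ ⟩
  addZ (addZ w w) (mulZ w w) ∎
  where
  open ≡-Reasoning
  w = subZ u oneZ
  expand : mulZ (addZ oneZ w) (addZ oneZ w) ≡ addZ oneZ (addZ (addZ w w) (mulZ w w))
  expand = begin
    mulZ (addZ oneZ w) (addZ oneZ w)
      ≡⟨ mulAux-addZˡ oneZ w _ ⟩
    addZ (mulZ oneZ (addZ oneZ w)) (mulZ w (addZ oneZ w))
      ≡⟨ cong₂ addZ (mulZ-identityˡ _) (mulAux-addZʳ w oneZ w) ⟩
    addZ (addZ oneZ w) (addZ (mulZ w oneZ) (mulZ w w))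
      ≡⟨ cong (λ v → addZ (addZ oneZ w) (addZ v (mulZ w w))) (mulZ-identityʳ w) ⟩
    addZ (addZ oneZ w) (addZ w (mulZ w w))
      ≡⟨ addZ-assoc oneZ w _ ⟩
    addZ oneZ (addZ w (addZ w (mulZ w w)))
      ≡⟨ cong (addZ oneZ) (addZ-assoc w w (mulZ w w)) ⟨
    addZ oneZ (addZ (addZ w w) (mulZ w w)) ∎

-- Congruences modulo an integer

lookup-init : (v : Vec ℤ (suc n)) (i : Fin n) → lookup (init v) i ≡ lookup v (inject₁ i)
lookup-init (x ∷ y ∷ v) zero    = refl
lookup-init (x ∷ y ∷ v) (suc i) = lookup-init (y ∷ v) i

last-lookup : (v : Vec ℤ (suc n)) → last v ≡ lookup v (fromℕ n)
last-lookup (x ∷ [])    = refl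
last-lookup (x ∷ y ∷ v) = last-lookup (y ∷ v)

infix 4 _≡_[modᶻ_] _≡_[mod_] _∣ᵛ_

record _≡_[modᶻ_] (x y d : ℤ) : Set where
  constructor mod
  field divides-diff : d ∣ᶻ x - y
open _≡_[modᶻ_]

record _≡_[mod_] (u v : Vec ℤ n) (d : ℤ) : Set where
  constructor pointwise
  field at : ∀ i → lookup u i ≡ lookup v i [modᶻ d ]
open _≡_[mod_]

module _ {d : ℤ} where

  ≡ᶻ-refl : ∀ x → x ≡ x [modᶻ d ]
  ≡ᶻ-refl x = mod (divides (+ 0) (trans (ℤ.+-inverseʳ x) (sym (ℤ.*-zeroˡ d))))

  ≡ᶻ-sym : ∀ {x y} → x ≡ y [modᶻ d ] → y ≡ x [modᶻ d ]
  ≡ᶻ-sym {x} {y} (mod p) = mod (subst (d ∣ᶻ_) (flip x y) (∣n⇒∣m*n (- + 1) p))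
    where
    flip : ∀ x y → - + 1 * (x - y) ≡ y - x
    flip = solve-∀

  ≡ᶻ-trans : ∀ {x y z} → x ≡ y [modᶻ d ] → y ≡ z [modᶻ d ] → x ≡ z [modᶻ d ]
  ≡ᶻ-trans {x} {y} {z} (mod p) (mod q) = mod (subst (d ∣ᶻ_) (telescope x y z) (∣m∣n⇒∣m+n p q))
    where
    telescope : ∀ x y z → (x - y) + (y - z) ≡ x - z
    telescope = solve-∀

  ≡ᶻ-weaken : ∀ {d′ x y} → d ∣ᶻ d′ → x ≡ y [modᶻ d′ ] → x ≡ y [modᶻ d ]
  ≡ᶻ-weaken d∣d′ (mod p) = mod (∣-trans d∣d′ p)

  +-≡ᶻ-cong : ∀ {x x′ y y′} → x ≡ x′ [modᶻ d ] → y ≡ y′ [modᶻ d ] → x + y ≡ x′ + y′ [modᶻ d ]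
  +-≡ᶻ-cong {x} {x′} {y} {y′} (mod p) (mod q) = mod (subst (d ∣ᶻ_) (regroup x x′ y y′) (∣m∣n⇒∣m+n p q))
    where
    regroup : ∀ x x′ y y′ → (x - x′) + (y - y′) ≡ (x + y) - (x′ + y′)
    regroup = solve-∀

  *-≡ᶻ-cong : ∀ {x x′ y y′} → x ≡ x′ [modᶻ d ] → y ≡ y′ [modᶻ d ] → x * y ≡ x′ * y′ [modᶻ d ]
  *-≡ᶻ-cong {x} {x′} {y} {y′} (mod p) (mod q) =
    mod (subst (d ∣ᶻ_) (regroup x x′ y y′) (∣m∣n⇒∣m+n (∣n⇒∣m*n x q) (∣m⇒∣m*n y′ p)))
    where
    regroup : ∀ x x′ y y′ → x * (y - y′) + (x - x′) * y′ ≡ x * y - x′ * y′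
    regroup = solve-∀

  ≡-mod-refl : (u : Vec ℤ n) → u ≡ u [mod d ]
  ≡-mod-refl u = pointwise λ i → ≡ᶻ-refl (lookup u i)

  ≡-mod-reflexive : {u v : Vec ℤ n} → u ≡ v → u ≡ v [mod d ]
  ≡-mod-reflexive {u = u} refl = ≡-mod-refl u

  ≡-mod-sym : {u v : Vec ℤ n} → u ≡ v [mod d ] → v ≡ u [mod d ]
  ≡-mod-sym p = pointwise λ i → ≡ᶻ-sym (at p i)

  ≡-mod-trans : {u v w : Vec ℤ n} → u ≡ v [mod d ] → v ≡ w [mod d ] → u ≡ w [mod d ]
  ≡-mod-trans p q = pointwise λ i → ≡ᶻ-trans (at p i) (at q i)

  ≡-mod-weaken : ∀ {d′} {u v : Vec ℤ n} → d ∣ᶻ d′ → u ≡ v [mod d′ ] → u ≡ v [mod d ]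
  ≡-mod-weaken d∣d′ p = pointwise λ i → ≡ᶻ-weaken d∣d′ (at p i)

  addZ-cong : {a a′ b b′ : ZPi e} → a ≡ a′ [mod d ] → b ≡ b′ [mod d ] → addZ a b ≡ addZ a′ b′ [mod d ]
  addZ-cong {a = a} {a′} {b} {b′} p q = pointwise λ i →
    subst₂ (_≡_[modᶻ d ]) (sym (lookup-zipWith _+_ i a b)) (sym (lookup-zipWith _+_ i a′ b′))
      (+-≡ᶻ-cong (at p i) (at q i))

  subZ-congˡ : {u v : Vec ℤ n} (w : Vec ℤ n) → u ≡ v [mod d ] → subZ u w ≡ subZ v w [mod d ]
  subZ-congˡ {u = u} {v} w p = pointwise λ i →
    subst₂ (_≡_[modᶻ d ]) (sym (lookup-zipWith _-_ i u w)) (sym (lookup-zipWith _-_ i v w))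
      (+-≡ᶻ-cong (at p i) (≡ᶻ-refl (- lookup w i)))

  scaleZ-cong : ∀ {c c′} {b b′ : ZPi e} → c ≡ c′ [modᶻ d ] → b ≡ b′ [mod d ] →
                scaleZ c b ≡ scaleZ c′ b′ [mod d ]
  scaleZ-cong {c = c} {c′} {b} {b′} p q = pointwise λ i →
    subst₂ (_≡_[modᶻ d ]) (sym (lookup-map i (c *_) b)) (sym (lookup-map i (c′ *_) b′))
      (*-≡ᶻ-cong p (at q i))

  mulπ-cong : {u v : ZPi e} → u ≡ v [mod d ] → mulπ u ≡ mulπ v [mod d ]
  mulπ-cong {zero}          p = pointwise λ ()
  mulπ-cong {suc e} {u} {v} p = pointwise λ where
    zero    → subst₂ (λ x y → + 2 * x ≡ + 2 * y [modᶻ d ]) (sym (last-lookup u)) (sym (last-lookup v))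
                (*-≡ᶻ-cong (≡ᶻ-refl (+ 2)) (at p (fromℕ e)))
    (suc i) → subst₂ (_≡_[modᶻ d ]) (sym (lookup-init u i)) (sym (lookup-init v i)) (at p (inject₁ i))

  mulAux-cong : {a a′ : Vec ℤ n} {b b′ : ZPi e} → a ≡ a′ [mod d ] → b ≡ b′ [mod d ] →
                mulAux a b ≡ mulAux a′ b′ [mod d ]
  mulAux-cong {a = []}    {[]}      p q = ≡-mod-refl zeroZ
  mulAux-cong {a = x ∷ a} {x′ ∷ a′} p q =
    addZ-cong (scaleZ-cong {c = x} {x′} (at p zero) q)
              (mulπ-cong (mulAux-cong {a = a} {a′} (pointwise (at p ∘ suc)) q))

  powZ-cong : {u v : ZPi e} (k : ℕ) → u ≡ v [mod d ] → powZ u k ≡ powZ v k [mod d ]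
  powZ-cong zero    p = ≡-mod-refl oneZ
  powZ-cong (suc k) p = mulAux-cong p (powZ-cong k p)

≡-mod-setoid : ℕ → ℤ → Setoid 0ℓ 0ℓ
≡-mod-setoid n d = record
  { Carrier       = Vec ℤ n
  ; _≈_           = _≡_[mod d ]
  ; isEquivalence = record { refl = ≡-mod-refl _ ; sym = ≡-mod-sym ; trans = ≡-mod-trans }
  }

module ≡-mod-Reasoning {n : ℕ} {d : ℤ} = Relation.Binary.Reasoning.Setoid (≡-mod-setoid n d)

≡-mod-one : (u v : Vec ℤ n) → u ≡ v [mod + 1 ]
≡-mod-one u v = pointwise λ i → mod (divides (lookup u i - lookup v i) (sym (ℤ.*-identityʳ _)))

pos-2^ : ∀ l → + (2 ℕ.^ l) ≡ (+ 2) ^ l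
pos-2^ zero    = refl
pos-2^ (suc l) = trans (ℤ.pos-* 2 (2 ℕ.^ l)) (cong (+ 2 *_) (pos-2^ l))

congMod⇒≡-mod : ∀ l {u v : ZPi e} → CongMod l u v → u ≡ v [mod (+ 2) ^ l ]
congMod⇒≡-mod l p = pointwise λ i → mod (subst (_∣ᶻ _) (pos-2^ l) (∣ᵤ⇒∣ (p i)))

≡-mod⇒congMod : ∀ l {u v : ZPi e} → u ≡ v [mod (+ 2) ^ l ] → CongMod l u v
≡-mod⇒congMod l p i = ∣⇒∣ᵤ (subst (_∣ᶻ _) (sym (pos-2^ l)) (divides-diff (at p i)))

2∣2^suc : ∀ n → + 2 ∣ᶻ (+ 2) ^ suc n
2∣2^suc n = divides ((+ 2) ^ n) (ℤ.*-comm (+ 2) _)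

Even : ℤ → Set
Even x = + 2 ∣ᶻ x

Odd : ℤ → Set
Odd x = x ≡ + 1 [modᶻ + 2 ]

parity : ∀ x → Even x ⊎ Odd x
parity x with x %ℕ 2 | n%ℕd<d x 2 | a≡a%ℕn+[a/ℕn]*n x 2
... | 0           | _            | x≡q*2   = inj₁ (divides (x /ℕ 2) (trans x≡q*2 (ℤ.+-identityˡ _)))
... | 1           | _            | x≡1+q*2 =
  inj₂ (mod (divides (x /ℕ 2) (trans (cong (_- + 1) x≡1+q*2) (cancel (x /ℕ 2)))))
  where
  cancel : ∀ q → + 1 + q * + 2 - + 1 ≡ q * + 2
  cancel = solve-∀
... | suc (suc _) | s≤s (s≤s ()) | _

¬2∣1 : ¬ (+ 2 ∣ᶻ + 1)
¬2∣1 2∣1 with ℕ.∣1⇒≡1 (∣⇒∣ᵤ 2∣1)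
... | ()

even⇒¬odd : ∀ {x} → Even x → ¬ Odd x
even⇒¬odd {x} x-even (mod x-odd) = ¬2∣1 (subst (+ 2 ∣ᶻ_) (cancel x) (∣m∣n⇒∣m-n x-even x-odd))
  where
  cancel : ∀ x → x - (x - + 1) ≡ + 1
  cancel = solve-∀

even⇒pred-odd : ∀ {x} → Even x → Odd (x - + 1)
even⇒pred-odd (divides q refl) = mod (divides (q - + 1) (regroup q))
  where
  regroup : ∀ q → q * + 2 - + 1 - + 1 ≡ (q - + 1) * + 2
  regroup = solve-∀

-- Powers of units

_∣ᵛ_ : ℤ → Vec ℤ n → Set
d ∣ᵛ v = ∀ i → d ∣ᶻ lookup v i

∣ᵛ-subZ⇒≡-mod : (u v : Vec ℤ n) → d ∣ᵛ subZ u v → u ≡ v [mod d ]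
∣ᵛ-subZ⇒≡-mod {d = d} u v p = pointwise λ i → mod (subst (d ∣ᶻ_) (lookup-zipWith _-_ i u v) (p i))

*-pres-∣ᶻ : ∀ {d d′ x y} → d ∣ᶻ x → d′ ∣ᶻ y → d * d′ ∣ᶻ x * y
*-pres-∣ᶻ {d} {d′} (divides q refl) (divides q′ refl) = divides (q * q′) (regroup q d q′ d′)
  where
  regroup : ∀ q d q′ d′ → (q * d) * (q′ * d′) ≡ (q * q′) * (d * d′)
  regroup = solve-∀

∣ᵛ-zeroZ : d ∣ᵛ zeroZ {n}
∣ᵛ-zeroZ {d} i = divides (+ 0) (trans (lookup-replicate i (+ 0)) (sym (ℤ.*-zeroˡ d)))

∣ᵛ-addZ : (u v : Vec ℤ n) → d ∣ᵛ u → d ∣ᵛ v → d ∣ᵛ addZ u v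
∣ᵛ-addZ {d = d} u v p q i = subst (d ∣ᶻ_) (sym (lookup-zipWith _+_ i u v)) (∣m∣n⇒∣m+n (p i) (q i))

∣ᵛ-double : (u : Vec ℤ n) → d ∣ᵛ u → + 2 * d ∣ᵛ addZ u u
∣ᵛ-double {d = d} u p i = subst (+ 2 * d ∣ᶻ_) (trans (double (lookup u i)) (sym (lookup-zipWith _+_ i u u)))
  (*-pres-∣ᶻ {+ 2} {d} {+ 2} ∣-refl (p i))
  where
  double : ∀ x → + 2 * x ≡ x + x
  double = solve-∀

∣ᵛ-mulπ : (u : ZPi e) → d ∣ᵛ u → d ∣ᵛ mulπ u
∣ᵛ-mulπ {suc e} {d} u p zero    = subst (λ x → d ∣ᶻ + 2 * x) (sym (last-lookup u)) (∣n⇒∣m*n (+ 2) (p (fromℕ e)))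
∣ᵛ-mulπ {suc e} {d} u p (suc i) = subst (d ∣ᶻ_) (sym (lookup-init u i)) (p (inject₁ i))

∣ᵛ-mulAux : ∀ {d′} (a : Vec ℤ n) (b : ZPi e) → d ∣ᵛ a → d′ ∣ᵛ b → d * d′ ∣ᵛ mulAux a b
∣ᵛ-mulAux []      b p q = ∣ᵛ-zeroZ
∣ᵛ-mulAux {d = d} {d′} (x ∷ a) b p q =
  ∣ᵛ-addZ (scaleZ x b) _
    (λ i → subst (d * d′ ∣ᶻ_) (sym (lookup-map i (x *_) b)) (*-pres-∣ᶻ (p zero) (q i)))
    (∣ᵛ-mulπ (mulAux a b) (∣ᵛ-mulAux a b (p ∘ suc) q))

∣ᵛ-square-sub-one : (u : ZPi e) → + 2 ∣ᶻ d → d ∣ᵛ subZ u oneZ → + 2 * d ∣ᵛ subZ (mulZ u u) oneZ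
∣ᵛ-square-sub-one {d = d} u 2∣d p = subst (+ 2 * d ∣ᵛ_) (sym (square-sub-one u))
  (∣ᵛ-addZ (addZ w w) (mulZ w w) (∣ᵛ-double w p)
    (λ i → ∣-trans (*-monoˡ-∣ d 2∣d) (∣ᵛ-mulAux w w p p i)))
  where
  w = subZ u oneZ

-- EvenBelow j v says that v ∈ π^j Z[π] + 2 Z[π].
EvenBelow : ℕ → Vec ℤ n → Set
EvenBelow j v = ∀ i → toℕ i ℕ.< j → Even (lookup v i)

evenBelow-addZ : (u v : Vec ℤ n) → EvenBelow j u → EvenBelow j v → EvenBelow j (addZ u v)
evenBelow-addZ u v p q i i<j = subst Even (sym (lookup-zipWith _+_ i u v)) (∣m∣n⇒∣m+n (p i i<j) (q i i<j))

evenBelow-double : (u : Vec ℤ n) → EvenBelow j (addZ u u)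
evenBelow-double u i _ = subst Even (sym (lookup-zipWith _+_ i u u)) (divides (lookup u i) (double (lookup u i)))
  where
  double : ∀ x → x + x ≡ x * + 2
  double = solve-∀

evenBelow-mulπ : (u : ZPi e) → EvenBelow j u → EvenBelow (suc j) (mulπ u)
evenBelow-mulπ {suc e} u p zero    _         = divides (last u) (ℤ.*-comm (+ 2) (last u))
evenBelow-mulπ {suc e} u p (suc i) (s≤s i<j) =
  subst Even (sym (lookup-init u i)) (p (inject₁ i) (subst (ℕ._< _) (sym (toℕ-inject₁ i)) i<j))

evenBelow-mulAux : (t : Vec ℤ n) (y : ZPi e) → EvenBelow j y → EvenBelow j (mulAux t y)
evenBelow-mulAux []      y p i _ = ∣ᵛ-zeroZ i
evenBelow-mulAux (x ∷ t) y p =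
  evenBelow-addZ (scaleZ x y) _
    (λ i i<j → subst Even (sym (lookup-map i (x *_) y)) (∣n⇒∣m*n x (p i i<j)))
    (λ i i<j → evenBelow-mulπ (mulAux t y) (evenBelow-mulAux t y p) i (ℕ.m≤n⇒m≤1+n i<j))

evenBelow-mulZ-even : (w y : ZPi (suc e)) → Even (lookup w zero) → EvenBelow j y →
                      EvenBelow (suc j) (mulZ w y)
evenBelow-mulZ-even (x ∷ t) y x-even p =
  evenBelow-addZ (scaleZ x y) _
    (λ i _ → subst Even (sym (lookup-map i (x *_) y)) (∣m⇒∣m*n (lookup y i) x-even))
    (evenBelow-mulπ (mulAux t y) (evenBelow-mulAux t y p))

evenBelow-square-sub-one : (u : ZPi (suc e)) → EvenBelow (suc j) (subZ u oneZ) →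
                           EvenBelow (suc (suc j)) (subZ (mulZ u u) oneZ)
evenBelow-square-sub-one u p = subst (EvenBelow (suc (suc _))) (sym (square-sub-one u))
  (evenBelow-addZ (addZ w w) (mulZ w w) (evenBelow-double w)
    (evenBelow-mulZ-even w w (p zero (s≤s z≤n)) p))
  where
  w = subZ u oneZ

evenBelow-1-sub-oneZ : (u : ZPi (suc e)) → Odd (lookup u zero) → EvenBelow 1 (subZ u oneZ)
evenBelow-1-sub-oneZ u (mod u₀-odd) zero    _        = subst Even (sym (lookup-zipWith _-_ zero u oneZ)) u₀-odd
evenBelow-1-sub-oneZ u _            (suc i) (s≤s ())

-- The first m squarings move u - 1 from π Z[π] + 2 Z[π] into 2 Z[π]; each further one gains a factor 2.
unit-pow-≡-one : ∀ {m} (u : ZPi (suc m)) → Odd (lookup u zero) →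
                 ∀ n → powZ u (2 ℕ.^ (n ℕ.+ m)) ≡ oneZ [mod (+ 2) ^ suc n ]
unit-pow-≡-one {m} u u-unit n = ∣ᵛ-subZ⇒≡-mod _ oneZ (divisible n)
  where
  evenBelow : ∀ t → EvenBelow (suc t) (subZ (powZ u (2 ℕ.^ t)) oneZ)
  evenBelow zero    = subst (λ v → EvenBelow 1 (subZ v oneZ)) (sym (mulZ-identityʳ u))
                        (evenBelow-1-sub-oneZ u u-unit)
  evenBelow (suc t) = subst (λ v → EvenBelow (suc (suc t)) (subZ v oneZ)) (sym (powZ-double u (2 ℕ.^ t)))
                        (evenBelow-square-sub-one (powZ u (2 ℕ.^ t)) (evenBelow t))

  divisible : ∀ n → (+ 2) ^ suc n ∣ᵛ subZ (powZ u (2 ℕ.^ (n ℕ.+ m))) oneZ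
  divisible zero    i = evenBelow m i (toℕ<n i)
  divisible (suc n) = subst (λ v → (+ 2) ^ suc (suc n) ∣ᵛ subZ v oneZ) (sym (powZ-double u (2 ℕ.^ (n ℕ.+ m))))
    (∣ᵛ-square-sub-one (powZ u (2 ℕ.^ (n ℕ.+ m))) (2∣2^suc n) (divisible n))

powZ-≡-period : ∀ {N} (g : ZPi e) → powZ g N ≡ oneZ [mod d ] →
                ∀ a c → powZ g (a ℕ.+ c ℕ.* N) ≡ powZ g a [mod d ]
powZ-≡-period {N = N} g g^N≡1 a c = begin
  powZ g (a ℕ.+ c ℕ.* N)               ≡⟨ powZ-+ g a (c ℕ.* N) ⟩
  mulZ (powZ g a) (powZ g (c ℕ.* N))    ≡⟨ cong (mulZ (powZ g a)) (powZ-* g c N) ⟩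
  mulZ (powZ g a) (powZ (powZ g N) c)   ≈⟨ mulAux-cong (≡-mod-refl (powZ g a)) (powZ-cong c g^N≡1) ⟩
  mulZ (powZ g a) (powZ oneZ c)         ≡⟨ cong (mulZ (powZ g a)) (powZ-oneZ c) ⟩
  mulZ (powZ g a) oneZ                  ≡⟨ mulZ-identityʳ (powZ g a) ⟩
  powZ g a                              ∎
  where open ≡-mod-Reasoning

-- k-th roots of units

odd⇒≡1+c*2 : ∀ k → ¬ 2 ∣ k → ∃ λ c → k ≡ 1 ℕ.+ c ℕ.* 2
odd⇒≡1+c*2 zero          k-odd = ⊥-elim (k-odd (ℕ.divides 0 refl))
odd⇒≡1+c*2 (suc zero)    _     = 0 , refl
odd⇒≡1+c*2 (suc (suc k)) k-odd with odd⇒≡1+c*2 k (k-odd ∘ ℕ.∣m∣n⇒∣m+n ℕ.∣-refl)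
... | c , refl = suc c , refl

odd-pow-2^ : ∀ {k} → ¬ 2 ∣ k → ∀ j → ∃ λ c → k ℕ.^ 2 ℕ.^ j ≡ 1 ℕ.+ c ℕ.* 2 ℕ.^ suc j
odd-pow-2^ {k} k-odd zero with odd⇒≡1+c*2 k k-odd
... | c , k≡1+c*2 = c , trans (ℕ.^-identityʳ k) k≡1+c*2
odd-pow-2^ {k} k-odd (suc j) with odd-pow-2^ k-odd j
... | c , k^P≡1+c*2P = c ℕ.+ c ℕ.* c ℕ.* P , (begin
  k ℕ.^ (2 ℕ.* P)                    ≡⟨ cong (k ℕ.^_) (ℕ.*-comm 2 P) ⟩
  k ℕ.^ (P ℕ.* 2)                    ≡⟨ ℕ.^-*-assoc k P 2 ⟨
  (k ℕ.^ P) ℕ.^ 2                    ≡⟨ cong (ℕ._^ 2) k^P≡1+c*2P ⟩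
  (1 ℕ.+ c ℕ.* (2 ℕ.* P)) ℕ.^ 2      ≡⟨ square c P ⟩
  1 ℕ.+ (c ℕ.+ c ℕ.* c ℕ.* P) ℕ.* (2 ℕ.* (2 ℕ.* P)) ∎)
  where
  open ≡-Reasoning
  P = 2 ℕ.^ j
  square : ∀ c p → (1 ℕ.+ c ℕ.* (2 ℕ.* p)) ℕ.* ((1 ℕ.+ c ℕ.* (2 ℕ.* p)) ℕ.* 1) ≡
                   1 ℕ.+ (c ℕ.+ c ℕ.* c ℕ.* p) ℕ.* (2 ℕ.* (2 ℕ.* p))
  square = ℕ.solve-∀

-- Units of Z[π]/2ⁿ satisfy u ^ period n ≡ 1, and rootExponent n = k ^ (period n ∸ 1) is an
-- inverse of k modulo period n.
module KthRoots {m k : ℕ} (k-odd : ¬ 2 ∣ k) where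

  period : ℕ → ℕ
  period n = 2 ℕ.^ (n ℕ.+ m)

  k^period : ∀ n → ∃ λ c → k ℕ.^ period n ≡ 1 ℕ.+ c ℕ.* period n
  k^period n with odd-pow-2^ k-odd (n ℕ.+ m)
  ... | c , eq = c ℕ.* 2 , trans eq (cong suc (sym (ℕ.*-assoc c 2 (period n))))

  rootExponent : ℕ → ℕ
  rootExponent zero    = k ℕ.^ (2 ℕ.^ m ℕ.∸ 1)
  rootExponent (suc n) = rootExponent n ℕ.* k ℕ.^ period n

  k*rootExponent : ∀ n → k ℕ.* rootExponent n ≡ k ℕ.^ period n
  k*rootExponent zero    = cong (k ℕ.^_) (ℕ.m+[n∸m]≡n (ℕ.m^n>0 2 m))
  k*rootExponent (suc n) = begin
    k ℕ.* (rootExponent n ℕ.* k ℕ.^ P)   ≡⟨ ℕ.*-assoc k (rootExponent n) _ ⟨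
    k ℕ.* rootExponent n ℕ.* k ℕ.^ P     ≡⟨ cong (ℕ._* k ℕ.^ P) (k*rootExponent n) ⟩
    k ℕ.^ P ℕ.* k ℕ.^ P                  ≡⟨ ℕ.^-distribˡ-+-* k P P ⟨
    k ℕ.^ (P ℕ.+ P)                      ≡⟨ cong (λ Q → k ℕ.^ (P ℕ.+ Q)) (ℕ.+-identityʳ P) ⟨
    k ℕ.^ period (suc n)                 ∎
    where
    open ≡-Reasoning
    P = period n

  k*rootExponent≡1+c*period : ∀ n → ∃ λ c → k ℕ.* rootExponent n ≡ 1 ℕ.+ c ℕ.* period n
  k*rootExponent≡1+c*period n with k^period n
  ... | c , eq = c , trans (k*rootExponent n) eq

  rootExponent-suc : ∀ n → ∃ λ c → rootExponent (suc n) ≡ rootExponent n ℕ.+ c ℕ.* period n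
  rootExponent-suc n with k^period n
  ... | c , eq = rootExponent n ℕ.* c ,
                 trans (cong (rootExponent n ℕ.*_) eq) (distrib (rootExponent n) c (period n))
    where
    distrib : ∀ a c p → a ℕ.* (1 ℕ.+ c ℕ.* p) ≡ a ℕ.+ a ℕ.* c ℕ.* p
    distrib = ℕ.solve-∀

  module _ (g : Seq (suc m)) (g-compatible : ∀ n → g (suc n) ≡ g n [mod (+ 2) ^ n ])
           (g-unit : ∀ n → Odd (lookup (g (suc n)) zero)) where

    g^period≡1 : ∀ n → powZ (g n) (period n) ≡ oneZ [mod (+ 2) ^ n ]
    g^period≡1 zero    = ≡-mod-one _ _
    g^period≡1 (suc n) = ≡-mod-weaken (divides (+ 2) refl) (unit-pow-≡-one (g (suc n)) (g-unit n) (suc n))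

    root : Seq (suc m)
    root n = powZ (g n) (rootExponent n)

    root-pow : ∀ n → powZ (root n) k ≡ g n [mod (+ 2) ^ n ]
    root-pow n with k*rootExponent≡1+c*period n
    ... | c , eq = begin
      powZ (powZ (g n) (rootExponent n)) k   ≡⟨ powZ-* (g n) k (rootExponent n) ⟨
      powZ (g n) (k ℕ.* rootExponent n)      ≡⟨ cong (powZ (g n)) eq ⟩
      powZ (g n) (1 ℕ.+ c ℕ.* period n)      ≈⟨ powZ-≡-period (g n) (g^period≡1 n) 1 c ⟩
      powZ (g n) 1                           ≡⟨ mulZ-identityʳ (g n) ⟩
      g n                                    ∎
      where open ≡-mod-Reasoning

    root-compatible : ∀ n → root (suc n) ≡ root n [mod (+ 2) ^ n ]
    root-compatible n with rootExponent-suc n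
    ... | c , eq = begin
      powZ (g (suc n)) (rootExponent (suc n))          ≈⟨ powZ-cong (rootExponent (suc n)) (g-compatible n) ⟩
      powZ (g n) (rootExponent (suc n))                ≡⟨ cong (powZ (g n)) eq ⟩
      powZ (g n) (rootExponent n ℕ.+ c ℕ.* period n)   ≈⟨ powZ-≡-period (g n) (g^period≡1 n) (rootExponent n) c ⟩
      powZ (g n) (rootExponent n)                      ∎
      where open ≡-mod-Reasoning

constant : ZPi e → Z2Root e
constant v = (λ _ → v) , λ l → ≡-mod⇒congMod l (≡-mod-refl v)

-- Level 0 of a compatible sequence is arbitrary, so being a unit is read off at level 1.
unit-is-kth-power : ∀ {m k} → ¬ 2 ∣ k → (y : Z2Root (suc m)) → Odd (lookup (proj₁ y 1) zero) →
                    Σ (Z2Root (suc m)) λ x → IsSumOfPowers k y (x ∷ [])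
unit-is-kth-power k-odd (g , g-compatible) g₁-unit =
  (root g compatible unit , λ l → ≡-mod⇒congMod l (root-compatible g compatible unit l)) ,
  λ l → ≡-mod⇒congMod l
          (≡-mod-sym (≡-mod-trans (≡-mod-reflexive (addZ-identityʳ _)) (root-pow g compatible unit l)))
  where
  open KthRoots k-odd
  compatible : ∀ n → g (suc n) ≡ g n [mod (+ 2) ^ n ]
  compatible n = congMod⇒≡-mod n (g-compatible n)
  unit : ∀ n → Odd (lookup (g (suc n)) zero)
  unit zero    = g₁-unit
  unit (suc n) = ≡ᶻ-trans (at (≡-mod-weaken (2∣2^suc n) (compatible (suc n))) zero) (unit n)

sum-of-two-kth-powers : ∀ {m k} → ¬ 2 ∣ k → (y : Z2Root (suc m)) →
                        Σ (List (Z2Root (suc m))) λ xs → (length xs ≤ 2) × IsSumOfPowers k y xs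
sum-of-two-kth-powers {m} {k} k-odd y@(f , f-compatible) with parity (lookup (f 1) zero)
... | inj₂ f₁-unit = let x , y≡x^k = unit-is-kth-power k-odd y f₁-unit in (x ∷ []) , s≤s z≤n , y≡x^k
... | inj₁ f₁-even = (constant oneZ ∷ x ∷ []) , s≤s (s≤s z≤n) , y≡1+x^k
  where
  y-1 : Z2Root (suc m)
  y-1 = (λ l → subZ (f l) oneZ) ,
        λ l → ≡-mod⇒congMod l (subZ-congˡ oneZ (congMod⇒≡-mod l {f (suc l)} {f l} (f-compatible l)))

  y-1-unit : Odd (lookup (subZ (f 1) oneZ) zero)
  y-1-unit = subst Odd (sym (lookup-zipWith _-_ zero (f 1) oneZ)) (even⇒pred-odd f₁-even)

  x : Z2Root (suc m)
  x = proj₁ (unit-is-kth-power k-odd y-1 y-1-unit)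

  y-1≡x^k : IsSumOfPowers k y-1 (x ∷ [])
  y-1≡x^k = proj₂ (unit-is-kth-power k-odd y-1 y-1-unit)

  y≡1+x^k : IsSumOfPowers k y (constant oneZ ∷ x ∷ [])
  y≡1+x^k l = ≡-mod⇒congMod l (begin
    f l                                                    ≡⟨ addZ-subZ (f l) oneZ ⟨
    addZ oneZ (subZ (f l) oneZ)                            ≈⟨ addZ-cong (≡-mod-reflexive (sym (powZ-oneZ k)))
                                                                        (congMod⇒≡-mod l (y-1≡x^k l)) ⟩
    addZ (powZ oneZ k) (addZ (powZ (proj₁ x l) k) zeroZ)   ∎)
    where open ≡-mod-Reasoning

-- π is not a k-th power

lookup-mulZ-zero : (a b : ZPi (suc e)) → lookup (mulZ a b) zero ≡ lookup a zero * lookup b zero [modᶻ + 2 ]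
lookup-mulZ-zero (x ∷ a) (y ∷ b) = mod (divides (last (mulAux a (y ∷ b))) (cancel (x * y) _))
  where
  cancel : ∀ p r → p + + 2 * r - p ≡ r * + 2
  cancel = solve-∀

odd-pow : (z : ZPi (suc e)) → Odd (lookup z zero) → ∀ j → Odd (lookup (powZ z j) zero)
odd-pow z z-unit zero    = ≡ᶻ-refl (+ 1)
odd-pow z z-unit (suc j) = ≡ᶻ-trans (lookup-mulZ-zero z (powZ z j)) (*-≡ᶻ-cong z-unit (odd-pow z z-unit j))

even⇒π-multiple : (z : ZPi (suc e)) → Even (lookup z zero) → ∃ λ w → z ≡ mulπ w
even⇒π-multiple (x ∷ t) (divides q x≡q*2) = t ∷ʳ q , (begin
  x ∷ t           ≡⟨ cong (_∷ t) (trans x≡q*2 (ℤ.*-comm q (+ 2))) ⟩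
  + 2 * q ∷ t     ≡⟨ mulπ-∷ʳ t q ⟨
  mulπ (t ∷ʳ q)   ∎)
  where open ≡-Reasoning

π-multiple-pow : (w : ZPi e) (j : ℕ) →
                 powZ (mulπ w) (2 ℕ.+ j) ≡ mulπ (mulπ (mulZ w (mulZ w (powZ (mulπ w) j))))
π-multiple-pow w j = begin
  mulZ (mulπ w) (mulZ (mulπ w) r)   ≡⟨ mulZ-mulπˡ w _ ⟩
  mulπ (mulZ w (mulZ (mulπ w) r))   ≡⟨ cong (mulπ ∘ mulZ w) (mulZ-mulπˡ w r) ⟩
  mulπ (mulZ w (mulπ (mulZ w r)))   ≡⟨ cong mulπ (mulAux-mulπʳ w (mulZ w r)) ⟩
  mulπ (mulπ (mulZ w (mulZ w r)))   ∎
  where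
  open ≡-Reasoning
  r = powZ (mulπ w) j

-- For e = 1 the ideal π² Z[π] is 4 Z[π]; for e ≥ 2 the coefficient of π in π² v is 2 · last v.
π-≢-π²-multiple : (v : ZPi (suc e)) → ¬ (mulπ oneZ ≡ mulπ (mulπ v) [mod + 4 ])
π-≢-π²-multiple {zero} (a ∷ []) p = ¬4∣2 (subst (+ 4 ∣ᶻ_) (cancel a) 4∣2-4a+4a)
  where
  4∣2-4a+4a : + 4 ∣ᶻ + 2 - + 2 * (+ 2 * a) + + 4 * a
  4∣2-4a+4a = ∣m∣n⇒∣m+n (divides-diff (at p zero)) (divides a (ℤ.*-comm (+ 4) a))
  cancel : ∀ a → + 2 - + 2 * (+ 2 * a) + + 4 * a ≡ + 2
  cancel = solve-∀
  ¬4∣2 : ¬ (+ 4 ∣ᶻ + 2)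
  ¬4∣2 4∣2 with ℕ.∣⇒≤ (∣⇒∣ᵤ 4∣2)
  ... | s≤s (s≤s ())
π-≢-π²-multiple {suc e} v p = even⇒¬odd (divides (last v) (ℤ.*-comm (+ 2) (last v))) (≡ᶻ-sym π₁≡2L)
  where
  π₁≡2L : + 1 ≡ + 2 * last v [modᶻ + 2 ]
  π₁≡2L = ≡ᶻ-weaken (divides (+ 2) refl)
    (subst₂ (_≡_[modᶻ + 4 ]) (lookup-init (oneZ {suc (suc e)}) zero) (lookup-init (mulπ v) zero)
      (at p (suc zero)))

π-≢-zero : ¬ (mulπ oneZ ≡ zeroZ {suc e} [mod + 4 ])
π-≢-zero p = π-≢-π²-multiple zeroZ (subst (mulπ oneZ ≡_[mod + 4 ]) zeroZ≡π²zeroZ p)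
  where
  zeroZ≡π²zeroZ : zeroZ ≡ mulπ (mulπ zeroZ)
  zeroZ≡π²zeroZ = sym (trans (cong mulπ mulπ-zeroZ) mulπ-zeroZ)

π-not-kth-power : ∀ {k} → 2 ≤ k → (z : ZPi (suc e)) → ¬ (mulπ oneZ ≡ powZ z k [mod + 4 ])
π-not-kth-power {e} {suc (suc j)} (s≤s (s≤s _)) z p with parity (lookup z zero)
... | inj₂ z-unit = even⇒¬odd (divides (last (oneZ {suc e})) (ℤ.*-comm (+ 2) _))
                      (≡ᶻ-trans (≡ᶻ-weaken (divides (+ 2) refl) (at p zero)) (odd-pow z z-unit (suc (suc j))))
... | inj₁ z-even with even⇒π-multiple z z-even
...   | w , refl = π-≢-π²-multiple _ (subst (mulπ oneZ ≡_[mod + 4 ]) (π-multiple-pow w j) p)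

π-in-powSemigroup : ∀ {m k} → ¬ 2 ∣ k → InPowSemigroup k (constant (mulπ (oneZ {suc m})))
π-in-powSemigroup k-odd with sum-of-two-kth-powers k-odd (constant (mulπ oneZ))
... | xs , _ , π≡Σxs^k = xs , π≡Σxs^k

¬WaringBound-1 : ∀ {m k} → 2 ≤ k → ¬ 2 ∣ k → ¬ WaringBound (suc m) k 1
¬WaringBound-1 2≤k k-odd bound with bound (constant (mulπ oneZ)) (π-in-powSemigroup k-odd)
... | []        , _      , π≡0   = π-≢-zero (congMod⇒≡-mod 2 (π≡0 2))
... | x ∷ []    , _      , π≡x^k = π-not-kth-power 2≤k (proj₁ x 2)
  (subst (mulπ oneZ ≡_[mod + 4 ]) (addZ-identityʳ _) (congMod⇒≡-mod 2 (π≡x^k 2)))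
... | _ ∷ _ ∷ _ , s≤s () , _

corollary3p2 : (k e : ℕ) → 3 ≤ k → ¬ (2 ∣ k) → 1 ≤ e → IsWaringNumber e k 2
corollary3p2 k zero    _   _     ()
corollary3p2 k (suc m) 3≤k k-odd _ = s≤s z≤n , (λ y _ → sum-of-two-kth-powers k-odd y) , minimal
  where
  minimal : ∀ g → 1 ≤ g → WaringBound (suc m) k g → 2 ≤ g
  minimal (suc zero)    _ bound = ⊥-elim (¬WaringBound-1 (ℕ.≤-trans (ℕ.n≤1+n 2) 3≤k) k-odd bound)
  minimal (suc (suc g)) _ _     = s≤s (s≤s z≤n)
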